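{- Let $\vec t=(t_n(x))_{n=0}^\infty,\ \vec t'=(t'_n(x))_{n=0}^\infty\in V^\infty(A)$ and $k,k',p_1,p'_1\in\mathbb{N}$ satisfy: (i) $k+p_1\leq k'+p'_1$; (ii) $(t_i(x))_{i=p_1}^\infty$ is a reduced $(k'+p'_1)$-block subsequence of $(t'_i(x))_{i=p'_1}^\infty$. Let $p_2\in\mathbb{N}$ with $p_2>p_1$. Then there exists $p'_2\in\mathbb{N}$ with $p'_2>p'_1$ such that: (a) $p_2-p_1\leq p'_2-p'_1$; (b) $k+p_2\leq k'+p'_2$; (c) $(t_i(x))_{i=p_2}^\infty$ is a reduced $(k'+p'_2)$-block subsequence of $(t'_i(x))_{i=p'_2}^\infty$; (d) $[(t_i(x))_{i=p_1}^{p_2-1}\parallel(A_{k+i})_{i=p_1}^{p_2-1}]_v\subseteq[(t'_i(x))_{i=p'_1}^{p'_2-1}\parallel(A_{k'+i})_{i=p'_1}^{p'_2-1}]_v$.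
   Context: $\mathbb{N}=\{0,1,2,\dots\}$. Fix an increasing sequence $A_0\subseteq A_1\subseteq\cdots$ of nonempty finite sets and let $A=\bigcup_nA_n$. Fix a symbol $x\notin A$. A variable word is a finite word over $A\cup\{x\}$ containing $x$ at least once; $V(A)$ is the set of variable words and $V^\infty(A)$ the set of infinite sequences of variable words. For $s(x)\in V(A)$ and $a\in A\cup\{x\}$, $s(a)$ replaces every occurrence of $x$ by $a$; words are concatenated by juxtaposition. For variable words $(s_n(x))_{n=p}^q$ and nonempty $B_p,\dots,B_q\subseteq A$, the reduced variable span is $[(s_n(x))_{n=p}^q\parallel(B_n)_{n=p}^q]_v=V(A)\cap\{s_p(b_p)\cdots s_q(b_q): b_n\in B_n\cup\{x\}\}$. For $k\in\mathbb{N}$ and $\vec s=(s_n(x))_{n=0}^\infty\in V^\infty(A)$, a finite sequence $(u_n(x))_{n=0}^l$ is a reduced $k$-block subsequence of $\vec s$ if there are $0=m_0<\dots<m_{l+1}$ with $u_i(x)\in[(s_n(x))_{n=m_i}^{m_{i+1}-1}\parallel(A_{k+n})_{n=m_i}^{m_{i+1}-1}]_v$ for $0\leq i\leq l$; an infinite sequence is a reduced $k$-block subsequence of $\vec s$ if all its finite initial segments are. A tail $(s_n(x))_{n=m}^\infty$ is regarded as the sequence $(s_{m+n}(x))_{n=0}^\infty$. -}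

module Defs where

open import Data.Nat using (ℕ; zero; suc; _+_; _∸_; _≤_; _<_)
open import Data.List using (List; []; _∷_; map; concatMap; applyUpTo)
open import Data.List.Membership.Propositional using (_∈_)
open import Data.List.Relation.Unary.All using (All)
open import Data.Maybe using (Maybe; just; nothing; maybe)
open import Data.Product using (Σ; ∃; _×_; _,_)
open import Data.Sum using (_⊎_)
open import Data.Unit using (⊤)
open import Relation.Binary.PropositionalEquality using (_≡_; _≢_)

-- Letters of the alphabet live in a type L; the variable symbol x is
-- represented by 'nothing', so x ∉ A automatically. A word over A ∪ {x}
-- is a list of 'Maybe L'.
Word : Set → Set
Word L = List (Maybe L)

x : {L : Set} → Maybe L
x = nothing

subst : {L : Set} → Word L → Maybe L → Word L
subst w c = map (maybe just c) w

range : ℕ → ℕ → List ℕ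
range a b = applyUpTo (a +_) (b ∸ a)

module _ {L : Set} (A : ℕ → List L) where

  Increasing : Set
  Increasing = ∀ n (a : L) → a ∈ A n → a ∈ A (suc n)

  Nonempty : Set
  Nonempty = ∀ n → A n ≢ []

  InA : L → Set
  InA a = ∃ λ n → a ∈ A n

  Letter : Maybe L → Set
  Letter c = maybe InA ⊤ c

  IsVarWord : Word L → Set
  IsVarWord w = All Letter w × (x ∈ w)

  IsVarSeq : (ℕ → Word L) → Set
  IsVarSeq s = ∀ n → IsVarWord (s n)

Allowed : {L : Set} → List L → Maybe L → Set
Allowed B c = c ≡ nothing ⊎ Σ _ λ a → c ≡ just a × a ∈ B

tail : {L : Set} → (ℕ → Word L) → ℕ → (ℕ → Word L)
tail s m n = s (m + n)

module _ {L : Set} (A : ℕ → List L) where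

  InSpan : (ℕ → Word L) → (ℕ → List L) → ℕ → ℕ → Word L → Set
  InSpan s B a b w =
    IsVarWord A w ×
    Σ (ℕ → Maybe L) λ ch →
      (∀ i → a ≤ i → i < b → Allowed (B i) (ch i)) ×
      (w ≡ concatMap (λ i → subst (s i) (ch i)) (range a b))

  RedBlockFin : ℕ → (ℕ → Word L) → ℕ → (ℕ → Word L) → Set
  RedBlockFin k u l s =
    Σ (ℕ → ℕ) λ m →
      (m 0 ≡ 0) ×
      (∀ i → i ≤ l → m i < m (suc i)) ×
      (∀ i → i ≤ l → InSpan s (λ n → A (k + n)) (m i) (m (suc i)) (u i))

  RedBlock : ℕ → (ℕ → Word L) → (ℕ → Word L) → Set
  RedBlock k u s = ∀ l → RedBlockFin k u l s

-- A reduced block subsequence comes with a partition of the indices of the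
-- coarser sequence into blocks; since variable words are nonempty, comparing
-- lengths shows that these partitions are unique, so the partitions for
-- longer and longer initial segments are compatible. Cutting after the first
-- p₂ − p₁ blocks therefore gives p₂' := p₁' + (end of those blocks), and the
-- tails still form a reduced block subsequence. For the span inclusion, a
-- word of the first span is a concatenation of blocks, each of which is a
-- word of the second span with x substituted by a letter; substituting into a
-- substitution is again a substitution, and the letters used stay admissible
-- because the sets A_n increase and every block starts at an index at least
-- its own position.
module Submission where

open import Defs
open import Data.Nat using (ℕ; zero; suc; _+_; _∸_; _≤_; _<_; _≤′_; ≤′-refl; ≤′-step; _<?_; s≤s; z<s; s<s)
open import Data.Nat.Properties
open import Data.List using (List; []; _++_; map; length; concatMap; applyUpTo)
open import Data.List.Properties using (map-++; map-∘; map-cong; length-map; length-++; length-++-≤ˡ; ++-assoc; ++-identityʳ)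
open import Data.List.Membership.Propositional using (_∈_)
open import Data.List.Relation.Unary.Any using (here; there)
open import Data.Maybe using (Maybe; just; nothing; maybe′)
open import Data.Product using (Σ; _×_; _,_; proj₁)
open import Data.Sum using (inj₁; inj₂)
open import Data.Bool using (if_then_else_)
open import Function using (_∘_)
open import Relation.Nullary using (¬_; does; yes; no; contradiction)
open import Relation.Nullary.Decidable using (dec-true; dec-false)
open import Relation.Binary using (tri<; tri≈; tri>)
open import Relation.Binary.PropositionalEquality
  using (_≡_; _≗_; refl; sym; trans; cong; cong₂; subst₂; module ≡-Reasoning)
  renaming (subst to transport)

private
  variable
    X Y L : Set
    A : ℕ → List L
    s s' u u' : ℕ → Word L
    B B' C : ℕ → List L
    w w' : Word L
    c c' : Maybe L
    E : List L
    a a' b i j d l l' m m' n K K' : ℕ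

m<n∸o⇒o+m<n : ∀ o → m < n ∸ o → o + m < n
m<n∸o⇒o+m<n zero                lt = lt
m<n∸o⇒o+m<n {n = zero}  (suc o) ()
m<n∸o⇒o+m<n {n = suc n} (suc o) lt = s<s (m<n∸o⇒o+m<n o lt)

concatUpTo : (ℕ → List X) → ℕ → List X
concatUpTo g zero    = []
concatUpTo g (suc n) = g 0 ++ concatUpTo (g ∘ suc) n

concatMap-applyUpTo : (h : Y → List X) (f : ℕ → Y) (n : ℕ) →
  concatMap h (applyUpTo f n) ≡ concatUpTo (h ∘ f) n
concatMap-applyUpTo h f zero    = refl
concatMap-applyUpTo h f (suc n) = cong (h (f 0) ++_) (concatMap-applyUpTo h (f ∘ suc) n)

concatUpTo-cong : {g h : ℕ → List X} (n : ℕ) → (∀ j → j < n → g j ≡ h j) →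
  concatUpTo g n ≡ concatUpTo h n
concatUpTo-cong zero    _   = refl
concatUpTo-cong (suc n) g≡h =
  cong₂ _++_ (g≡h 0 z<s) (concatUpTo-cong n (λ j j<n → g≡h (suc j) (s<s j<n)))

concatUpTo-+ : (g : ℕ → List X) (m n : ℕ) →
  concatUpTo g (m + n) ≡ concatUpTo g m ++ concatUpTo (λ j → g (m + j)) n
concatUpTo-+ g zero    n = refl
concatUpTo-+ g (suc m) n =
  trans (cong (g 0 ++_) (concatUpTo-+ (g ∘ suc) m n)) (sym (++-assoc (g 0) _ _))

concatUpTo-suc : (g : ℕ → List X) (n : ℕ) → concatUpTo g (suc n) ≡ concatUpTo g n ++ g n
concatUpTo-suc g zero    = ++-identityʳ (g 0)
concatUpTo-suc g (suc n) =
  trans (cong (g 0 ++_) (concatUpTo-suc (g ∘ suc) n)) (sym (++-assoc (g 0) _ _))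

map-concatUpTo : (f : X → Y) (g : ℕ → List X) (n : ℕ) →
  map f (concatUpTo g n) ≡ concatUpTo (map f ∘ g) n
map-concatUpTo f g zero    = refl
map-concatUpTo f g (suc n) = trans (map-++ f (g 0) _) (cong (map f (g 0) ++_) (map-concatUpTo f (g ∘ suc) n))

length-concatUpTo-cong : {g h : ℕ → List X} → (∀ j → length (g j) ≡ length (h j)) →
  ∀ n → length (concatUpTo g n) ≡ length (concatUpTo h n)
length-concatUpTo-cong         _      zero    = refl
length-concatUpTo-cong {g = g} {h} eq (suc n) = begin
  length (g 0 ++ concatUpTo (g ∘ suc) n)         ≡⟨ length-++ (g 0) ⟩
  length (g 0) + length (concatUpTo (g ∘ suc) n) ≡⟨ cong₂ _+_ (eq 0) (length-concatUpTo-cong (eq ∘ suc) n) ⟩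
  length (h 0) + length (concatUpTo (h ∘ suc) n) ≡⟨ length-++ (h 0) ⟨
  length (h 0 ++ concatUpTo (h ∘ suc) n)         ∎
  where open ≡-Reasoning

length-concatUpTo-< : {g : ℕ → List X} → (∀ j → 0 < length (g j)) →
  m < n → length (concatUpTo g m) < length (concatUpTo g n)
length-concatUpTo-< {m = zero}  {suc n} {g} nonempty _ = <-≤-trans (nonempty 0) (length-++-≤ˡ (g 0))
length-concatUpTo-< {m = suc m} {suc n} {g} nonempty (s<s m<n) =
  subst₂ _<_ (sym (length-++ (g 0))) (sym (length-++ (g 0)))
    (+-monoʳ-< (length (g 0)) (length-concatUpTo-< (nonempty ∘ suc) m<n))

length-concatUpTo-injective : {g : ℕ → List X} → (∀ j → 0 < length (g j)) →
  length (concatUpTo g m) ≡ length (concatUpTo g n) → m ≡ n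
length-concatUpTo-injective {m = m} {n} nonempty eq with <-cmp m n
... | tri< m<n _ _ = contradiction eq (<⇒≢ (length-concatUpTo-< nonempty m<n))
... | tri≈ _ m≡n _ = m≡n
... | tri> _ _ n<m = contradiction (sym eq) (<⇒≢ (length-concatUpTo-< nonempty n<m))

var-length-pos : IsVarWord A w → 0 < length w
var-length-pos (_ , here  _) = z<s
var-length-pos (_ , there _) = z<s

subst-subst : (w : Word L) (b c : Maybe L) → subst (subst w b) c ≡ subst w (maybe′ just c b)
subst-subst w b c = trans (sym (map-∘ w)) (map-cong compose w)
  where
  compose : ∀ y → maybe′ just c (maybe′ just b y) ≡ maybe′ just (maybe′ just c b) y
  compose (just _) = refl
  compose nothing  = refl

Allowed-subst : Allowed E c → Allowed E c' → Allowed E (maybe′ just c c')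
Allowed-subst c-ok (inj₁ refl)             = c-ok
Allowed-subst _    (inj₂ (e , refl , e∈E)) = inj₂ (e , refl , e∈E)

Increasing-∈ : Increasing A → i ≤′ j → {e : L} → e ∈ A i → e ∈ A j
Increasing-∈ inc ≤′-refl         e∈Ai = e∈Ai
Increasing-∈ inc (≤′-step i≤′j) e∈Ai = inc _ _ (Increasing-∈ inc i≤′j e∈Ai)

Allowed-mono : Increasing A → i ≤ j → Allowed (A i) c → Allowed (A j) c
Allowed-mono _   _   (inj₁ c≡x)              = inj₁ c≡x
Allowed-mono inc i≤j (inj₂ (e , c≡e , e∈Ai)) = inj₂ (e , c≡e , Increasing-∈ inc (≤⇒≤′ i≤j) e∈Ai)

Spanned : (ℕ → Word L) → (ℕ → List L) → ℕ → Word L → Set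
Spanned s B m w =
  Σ (ℕ → Maybe _) λ χ →
    (∀ n → n < m → Allowed (B n) (χ n)) × (w ≡ concatUpTo (λ n → subst (s n) (χ n)) m)

InSpan⇒Spanned : InSpan A s B a b w → Spanned (tail s a) (λ n → B (a + n)) (b ∸ a) w
InSpan⇒Spanned {s = s} {a = a} {b = b} (_ , ch , ch-ok , w≡) =
  (λ n → ch (a + n)) ,
  (λ n n<b∸a → ch-ok (a + n) (m≤m+n a n) (m<n∸o⇒o+m<n a n<b∸a)) ,
  trans w≡ (concatMap-applyUpTo (λ i → subst (s i) (ch i)) (a +_) (b ∸ a))

Spanned⇒InSpan : IsVarWord A w → Spanned (tail s a) (λ n → B (a + n)) (b ∸ a) w → InSpan A s B a b w
Spanned⇒InSpan {s = s} {a = a} {B = B} {b = b} w-var (χ , χ-ok , w≡) =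
  w-var , (λ i → χ (i ∸ a)) , ch-ok ,
  trans w≡ (trans (concatUpTo-cong (b ∸ a) λ n _ → cong (λ j → subst (s (a + n)) (χ j)) (sym (m+n∸m≡n a n)))
                  (sym (concatMap-applyUpTo (λ i → subst (s i) (χ (i ∸ a))) (a +_) (b ∸ a))))
  where
  ch-ok : ∀ i → a ≤ i → i < b → Allowed (B i) (χ (i ∸ a))
  ch-ok i a≤i i<b =
    transport (λ j → Allowed (B j) (χ (i ∸ a))) (m+[n∸m]≡n a≤i) (χ-ok (i ∸ a) (∸-monoˡ-< i<b a≤i))

Spanned-cong : s ≗ s' → Spanned s B m w → Spanned s' B m w
Spanned-cong {m = m} s≗s' (χ , χ-ok , w≡) =
  χ , χ-ok , trans w≡ (concatUpTo-cong m (λ n _ → cong (λ v → subst v (χ n)) (s≗s' n)))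

Spanned-weaken : (∀ n → n < m → ∀ {c} → Allowed (B n) c → Allowed (B' n) c) →
  Spanned s B m w → Spanned s B' m w
Spanned-weaken B⊆B' (χ , χ-ok , w≡) = χ , (λ n n<m → B⊆B' n n<m (χ-ok n n<m)) , w≡

Spanned-length : Spanned s B m w → length w ≡ length (concatUpTo s m)
Spanned-length {s = s} {m = m} (χ , _ , refl) = length-concatUpTo-cong (λ n → length-map _ (s n)) m

Spanned-subst : (∀ n → n < m → Allowed (B n) c) → Spanned s B m w → Spanned s B m (subst w c)
Spanned-subst {m = m} {c = c} {s = s} c-ok (χ , χ-ok , refl) =
  (λ n → maybe′ just c (χ n)) ,
  (λ n n<m → Allowed-subst (c-ok n n<m) (χ-ok n n<m)) ,
  trans (map-concatUpTo _ _ m) (concatUpTo-cong m (λ n _ → subst-subst (s n) (χ n) c))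

Spanned-++ : Spanned s B m w → Spanned (tail s m) (λ n → B (m + n)) m' w' →
  Spanned s B (m + m') (w ++ w')
Spanned-++ {s = s} {B = B} {m = m} {m' = m'} (χ , χ-ok , refl) (χ' , χ'-ok , refl) =
  ψ , ψ-ok ,
  sym (trans (concatUpTo-+ _ m m')
             (cong₂ _++_ (concatUpTo-cong m (λ n n<m → cong (subst (s n)) (ψ-below n<m)))
                         (concatUpTo-cong m' (λ j _ → cong (subst (s (m + j))) (ψ-above j)))))
  where
  ψ : ℕ → Maybe _
  ψ n = if does (n <? m) then χ n else χ' (n ∸ m)
  ψ-below : n < m → ψ n ≡ χ n
  ψ-below {n} n<m rewrite dec-true (n <? m) n<m = refl
  ψ-not-below : ¬ n < m → ψ n ≡ χ' (n ∸ m)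
  ψ-not-below {n} n≮m rewrite dec-false (n <? m) n≮m = refl
  ψ-above : ∀ j → ψ (m + j) ≡ χ' j
  ψ-above j = trans (ψ-not-below (m+n≮m m j)) (cong χ' (m+n∸m≡n m j))
  ψ-ok : ∀ n → n < m + m' → Allowed (B n) (ψ n)
  ψ-ok n n<m+m' with n <? m
  ... | yes n<m = transport (Allowed (B n)) (sym (ψ-below n<m)) (χ-ok n n<m)
  ... | no  n≮m = transport (Allowed (B n)) (sym (ψ-not-below n≮m))
                    (transport (λ j → Allowed (B j) (χ' (n ∸ m))) (m+[n∸m]≡n (≮⇒≥ n≮m))
                      (χ'-ok (n ∸ m) (transport (n ∸ m <_) (m+n∸m≡n m m') (∸-monoˡ-< n<m+m' (≮⇒≥ n≮m)))))

InSpan-length : InSpan A s B a b w → length w ≡ length (concatUpTo (tail s a) (b ∸ a))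
InSpan-length = Spanned-length ∘ InSpan⇒Spanned

InSpan-cong : s ≗ s' → InSpan A s B a b w → InSpan A s' B a b w
InSpan-cong {a = a} s≗s' S@(w-var , _) =
  Spanned⇒InSpan w-var (Spanned-cong (λ n → s≗s' (a + n)) (InSpan⇒Spanned S))

InSpan-tail : InSpan A s (λ n → A (K + n)) (d + a) (d + b) w →
  InSpan A (tail s d) (λ n → A (K + d + n)) a b w
InSpan-tail {A = A} {s = s} {K = K} {d = d} {a = a} {b = b} {w = w} S@(w-var , _) =
  Spanned⇒InSpan w-var
    (Spanned-weaken reassociate
      (Spanned-cong (λ n → cong s (+-assoc d a n))
        (transport (λ m → Spanned (tail s (d + a)) (λ n → A (K + (d + a + n))) m w)
           ([m+n]∸[m+o]≡n∸o d b a) (InSpan⇒Spanned S))))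
  where
  reassociate : ∀ n → n < b ∸ a → ∀ {c} → Allowed (A (K + (d + a + n))) c → Allowed (A (K + d + (a + n))) c
  reassociate n _ {c} = transport (λ i → Allowed (A i) c)
    (trans (cong (K +_) (+-assoc d a n)) (sym (+-assoc K d (a + n))))

boundary-gap : {M : ℕ → ℕ} → (∀ i → i ≤ l → M i < M (suc i)) →
  ∀ i j → i + j ≤ suc l → M i + j ≤ M (i + j)
boundary-gap {M = M} _ i zero _ = ≤-reflexive (trans (+-identityʳ (M i)) (cong M (sym (+-identityʳ i))))
boundary-gap {l = l} {M = M} M-inc i (suc j) i+1+j≤1+l = begin
  M i + suc j     ≡⟨ +-suc (M i) j ⟩
  suc (M i + j)   ≤⟨ s≤s (boundary-gap M-inc i j (≤-trans (+-monoʳ-≤ i (n≤1+n j)) i+1+j≤1+l)) ⟩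
  suc (M (i + j)) ≤⟨ M-inc (i + j) (≤-pred (transport (_≤ suc l) (+-suc i j) i+1+j≤1+l)) ⟩
  M (suc (i + j)) ≡⟨ cong M (+-suc i j) ⟨
  M (i + suc j)   ∎
  where open ≤-Reasoning

index≤boundary : (R : RedBlockFin A K u l s) → i ≤ suc l → i ≤ proj₁ R i
index≤boundary {i = i} (M , M0 , M-inc , _) i≤1+l =
  transport (λ z → z + i ≤ M i) M0 (boundary-gap M-inc 0 i i≤1+l)

boundary-unique : (∀ n → 0 < length (s n)) →
  (R : RedBlockFin A K u l s) (R' : RedBlockFin A K' u l' s) →
  i ≤ suc l → i ≤ suc l' → proj₁ R i ≡ proj₁ R' i
boundary-unique {i = zero} _ (_ , M0 , _) (_ , M'0 , _) _ _ = trans M0 (sym M'0)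
boundary-unique {s = s} {u = u} {i = suc i} nonempty
  R@(M , _ , M-inc , spans) R'@(M' , _ , M'-inc , spans') (s≤s i≤l) (s≤s i≤l') = begin
  M (suc i)                    ≡⟨ m+[n∸m]≡n (<⇒≤ (M-inc i i≤l)) ⟨
  M i + (M (suc i) ∸ M i)      ≡⟨ cong₂ _+_ Mi≡M'i same-width ⟩
  M' i + (M' (suc i) ∸ M' i)   ≡⟨ m+[n∸m]≡n (<⇒≤ (M'-inc i i≤l')) ⟩
  M' (suc i)                   ∎
  where
  open ≡-Reasoning
  Mi≡M'i : M i ≡ M' i
  Mi≡M'i = boundary-unique nonempty R R' (m≤n⇒m≤1+n i≤l) (m≤n⇒m≤1+n i≤l')
  same-width : M (suc i) ∸ M i ≡ M' (suc i) ∸ M' i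
  same-width = length-concatUpTo-injective (nonempty ∘ (M i +_))
    (trans (sym (InSpan-length (spans i i≤l)))
      (trans (InSpan-length (spans' i i≤l'))
        (cong (λ a → length (concatUpTo (tail s a) (M' (suc i) ∸ M' i))) (sym Mi≡M'i))))

RedBlockFin-drop : (R : RedBlockFin A K u (d + l) s) →
  RedBlockFin A (K + proj₁ R d) (tail u d) l (tail s (proj₁ R d))
RedBlockFin-drop {A = A} {K = K} {u = u} {d = d} {l = l} {s = s} (M , _ , M-inc , spans) =
  (λ i → M (d + i) ∸ M d) , starts-at-0 , increasing , blocks
  where
  Md≤ : i ≤ suc l → M d ≤ M (d + i)
  Md≤ {i} i≤1+l = ≤-trans (m≤m+n (M d) i)
    (boundary-gap M-inc d i (transport (d + i ≤_) (+-suc d l) (+-monoʳ-≤ d i≤1+l)))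
  split : i ≤ suc l → M (d + i) ≡ M d + (M (d + i) ∸ M d)
  split i≤1+l = sym (m+[n∸m]≡n (Md≤ i≤1+l))
  starts-at-0 : M (d + 0) ∸ M d ≡ 0
  starts-at-0 = trans (cong (λ j → M j ∸ M d) (+-identityʳ d)) (n∸n≡0 (M d))
  next : ∀ i → M (suc (d + i)) ≡ M (d + suc i)
  next i = cong M (sym (+-suc d i))
  increasing : ∀ i → i ≤ l → M (d + i) ∸ M d < M (d + suc i) ∸ M d
  increasing i i≤l = ∸-monoˡ-< (transport (M (d + i) <_) (next i) (M-inc (d + i) (+-monoʳ-≤ d i≤l)))
    (Md≤ (m≤n⇒m≤1+n i≤l))
  blocks : ∀ i → i ≤ l →
    InSpan A (tail s (M d)) (λ n → A (K + M d + n)) (M (d + i) ∸ M d) (M (d + suc i) ∸ M d) (u (d + i))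
  blocks i i≤l = InSpan-tail
    (subst₂ (λ a b → InSpan A s (λ n → A (K + n)) a b (u (d + i)))
      (split (m≤n⇒m≤1+n i≤l)) (trans (next i) (split (s≤s i≤l)))
      (spans (d + i) (+-monoʳ-≤ d i≤l)))

RedBlock-tail : (∀ n → 0 < length (s n)) → (H : RedBlock A K u s) (d : ℕ) →
  RedBlock A (K + proj₁ (H d) d) (tail u d) (tail s (proj₁ (H d) d))
RedBlock-tail {s = s} {A = A} {K = K} {u = u} nonempty H d l =
  transport (λ D → RedBlockFin A (K + D) (tail u d) l (tail s D)) same-boundary
    (RedBlockFin-drop (H (d + l)))
  where
  same-boundary : proj₁ (H (d + l)) d ≡ proj₁ (H d) d
  same-boundary = boundary-unique nonempty (H (d + l)) (H d) (≤-trans (m≤m+n d l) (n≤1+n _)) (n≤1+n d)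

RedBlock-cong : K ≡ K' → u ≗ u' → s ≗ s' → RedBlock A K u s → RedBlock A K' u' s'
RedBlock-cong refl u≗u' s≗s' H l with H l
... | M , M0 , M-inc , spans =
  M , M0 , M-inc , λ i i≤l → transport (InSpan _ _ _ _ _) (u≗u' i) (InSpan-cong s≗s' (spans i i≤l))

Spanned-blocks : {M : ℕ → ℕ} → M 0 ≡ 0 → (∀ q → q < d → M q < M (suc q)) →
  (∀ q → q < d → InSpan A s C (M q) (M (suc q)) (u q)) →
  (∀ q n {c} → q < d → M q ≤ n → Allowed (B q) c → Allowed (C n) c) →
  Spanned u B d w → Spanned s C (M d) w
Spanned-blocks {d = d} {s = s} {C = C} {u = u} {M = M} M0 M-inc blocks B⊆C (c , c-ok , refl) =
  prefix d ≤-refl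
  where
  G : ℕ → Word _
  G q = subst (u q) (c q)
  prefix : ∀ q → q ≤ d → Spanned s C (M q) (concatUpTo G q)
  prefix zero    _   = transport (λ m → Spanned s C m []) (sym M0) ((λ _ → x) , (λ _ ()) , refl)
  prefix (suc q) q<d =
    subst₂ (Spanned s C) (m+[n∸m]≡n (<⇒≤ (M-inc q q<d))) (sym (concatUpTo-suc G q))
      (Spanned-++ (prefix q (<⇒≤ q<d))
        (Spanned-subst (λ n _ → B⊆C q (M q + n) q<d (m≤m+n (M q) n) (c-ok q q<d))
          (InSpan⇒Spanned (blocks q q<d))))

InSpan-⊆ : Increasing A → K + a ≤ K' + a' →
  (R : RedBlockFin A (K' + a') (tail u a) (b ∸ a) (tail s a')) →
  InSpan A u (λ i → A (K + i)) a b w → InSpan A s (λ i → A (K' + i)) a' (a' + proj₁ R (b ∸ a)) w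
InSpan-⊆ {A = A} {K = K} {a = a} {K' = K'} {a' = a'} {u = u} {b = b} {s = s} {w = w}
  inc K+a≤K'+a' R@(M , M0 , M-inc , spans) S@(w-var , _) =
  Spanned⇒InSpan w-var
    (transport (λ m → Spanned (tail s a') (λ n → A (K' + (a' + n))) m w) (sym (m+n∸m≡n a' (M (b ∸ a))))
      (Spanned-weaken reassociate
        (Spanned-blocks M0 (λ q q<d → M-inc q (<⇒≤ q<d)) (λ q q<d → spans q (<⇒≤ q<d)) B⊆C
          (InSpan⇒Spanned S))))
  where
  B⊆C : ∀ q n {c} → q < b ∸ a → M q ≤ n → Allowed (A (K + (a + q))) c → Allowed (A (K' + a' + n)) c
  B⊆C q n q<d Mq≤n = Allowed-mono inc (begin
    K + (a + q) ≡⟨ +-assoc K a q ⟨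
    K + a + q   ≤⟨ +-mono-≤ K+a≤K'+a' (≤-trans (index≤boundary R (m≤n⇒m≤1+n (<⇒≤ q<d))) Mq≤n) ⟩
    K' + a' + n ∎)
    where open ≤-Reasoning
  reassociate : ∀ n → n < M (b ∸ a) → ∀ {c} → Allowed (A (K' + a' + n)) c → Allowed (A (K' + (a' + n))) c
  reassociate n _ = Allowed-mono inc (≤-reflexive (+-assoc K' a' n))

mainTheorem4 : {L : Set} (A : ℕ → List L) → Nonempty A → Increasing A →
    (t t' : ℕ → Word L) → IsVarSeq A t → IsVarSeq A t' →
    (k k' p₁ p₁' : ℕ) →
    k + p₁ ≤ k' + p₁' →
    RedBlock A (k' + p₁') (tail t p₁) (tail t' p₁') →
    (p₂ : ℕ) → p₁ < p₂ →
    Σ ℕ λ p₂' → p₁' < p₂' ×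
      (p₂ ∸ p₁ ≤ p₂' ∸ p₁') ×
      (k + p₂ ≤ k' + p₂') ×
      RedBlock A (k' + p₂') (tail t p₂) (tail t' p₂') ×
      (∀ w → InSpan A t (λ i → A (k + i)) p₁ p₂ w →
             InSpan A t' (λ i → A (k' + i)) p₁' p₂' w)
mainTheorem4 A _ inc t t' _ t'-var k k' p₁ p₁' k+p₁≤k'+p₁' H p₂ p₁<p₂ =
  p₁' + D , p₁'<p₂' , widths , levels , tails , λ _ → InSpan-⊆ inc k+p₁≤k'+p₁' (H δ)
  where
  δ : ℕ
  δ = p₂ ∸ p₁
  D : ℕ
  D = proj₁ (H δ) δ
  δ≤D : δ ≤ D
  δ≤D = index≤boundary (H δ) (n≤1+n δ)
  p₁+δ≡p₂ : p₁ + δ ≡ p₂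
  p₁+δ≡p₂ = m+[n∸m]≡n (<⇒≤ p₁<p₂)
  p₁'<p₂' : p₁' < p₁' + D
  p₁'<p₂' = m<m+n p₁' (<-≤-trans (m<n⇒0<n∸m p₁<p₂) δ≤D)
  widths : p₂ ∸ p₁ ≤ p₁' + D ∸ p₁'
  widths = transport (δ ≤_) (sym (m+n∸m≡n p₁' D)) δ≤D
  levels : k + p₂ ≤ k' + (p₁' + D)
  levels = begin
    k + p₂         ≡⟨ cong (k +_) p₁+δ≡p₂ ⟨
    k + (p₁ + δ)   ≡⟨ +-assoc k p₁ δ ⟨
    k + p₁ + δ     ≤⟨ +-mono-≤ k+p₁≤k'+p₁' δ≤D ⟩
    k' + p₁' + D   ≡⟨ +-assoc k' p₁' D ⟩
    k' + (p₁' + D) ∎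
    where open ≤-Reasoning
  tails : RedBlock A (k' + (p₁' + D)) (tail t p₂) (tail t' (p₁' + D))
  tails = RedBlock-cong (+-assoc k' p₁' D)
    (λ i → cong t (trans (sym (+-assoc p₁ δ i)) (cong (_+ i) p₁+δ≡p₂)))
    (λ n → cong t' (sym (+-assoc p₁' D n)))
    (RedBlock-tail (λ n → var-length-pos (t'-var (p₁' + n))) H δ)
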